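{- The commutative prelie algebra $(\mathbf{T}^{\mathcal D}_{CK},\curlyvee,\rhd)$ is generated, as a commutative prelie algebra, by the trees with exactly one edge, decorated by $d$, for $d\in\mathcal D$; that is, the smallest subspace of $\mathbf{T}^{\mathcal D}_{CK}$ containing these trees and stable under $\curlyvee$ and $\rhd$ is $\mathbf{T}^{\mathcal D}_{CK}$ itself.
   Context: $\mathbb{K}$ is a field of characteristic zero and $\mathcal D$ a nonempty set. $\mathbf{T}^{\mathcal D}_{CK}$ is the $\mathbb{K}$-vector space with basis the rooted trees (up to isomorphism) having at least one edge, whose edges are decorated by elements of $\mathcal D$. For such trees $T_1,T_2$ and a vertex $v$ of $T_2$, $T_1\circ_vT_2$ is obtained by identifying the root of $T_1$ with $v$ (the root of the result is the root $R_{T_2}$ of $T_2$). With $V^*(T)$ the set of non-root vertices of $T$, define bilinearly $T_1\curlyvee T_2=T_1\circ_{R_{T_2}}T_2$ and $T_1\rhd T_2=\sum_{s\in V^*(T_2)}T_1\circ_sT_2$; these make $\mathbf{T}^{\mathcal D}_{CK}$ a commutative prelie algebra ($\curlyvee$ commutative associative, $\rhd$ left prelie, and $x\rhd(y\curlyvee z)=(x\rhd y)\curlyvee z+(x\rhd z)\curlyvee y$). -}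

module Defs where

open import Level using (Level; _⊔_; suc)
open import Algebra.Bundles using (CommutativeRing)
open import Data.Nat as ℕ using (ℕ; zero)
open import Data.List using (List; []; _∷_; _++_; map; concatMap)
open import Data.Product using (Σ; _×_; _,_; proj₁; proj₂)
open import Data.Unit using (⊤; tt)
open import Data.Empty using (⊥)
open import Relation.Nullary using (¬_)
open import Relation.Binary.PropositionalEquality using (_≡_)

record Field (c ℓ : Level) : Set (suc (c ⊔ ℓ)) where
  field
    commutativeRing : CommutativeRing c ℓ
  open CommutativeRing commutativeRing public
  field
    1≉0     : ¬ (1# ≈ 0#)
    inverse : ∀ x → ¬ (x ≈ 0#) → Σ Carrier λ y → (x * y) ≈ 1#

module _ {c ℓ} (K : Field c ℓ) where
  open Field K
  natK : ℕ → Carrier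
  natK zero      = 0#
  natK (ℕ.suc n) = 1# + natK n

CharZero : ∀ {c ℓ} → Field c ℓ → Set ℓ
CharZero K = ∀ n → ¬ (natK K (ℕ.suc n) ≈ 0#)
  where open Field K

module CK {c ℓ} (K : Field c ℓ) (D : Set) where
  open Field K renaming (Carrier to 𝕂)

  -- a vertex together with the (unordered, represented as a list) family
  -- of its outgoing edges: each edge carries a decoration and a subtree
  data Tree : Set where
    node : List (D × Tree) → Tree

  kids : Tree → List (D × Tree)
  kids (node cs) = cs

  -- isomorphism of decorated rooted trees (children up to permutation)
  mutual
    data _≅_ : Tree → Tree → Set where
      node-cong : ∀ {cs ds} → cs ≅ᶠ ds → node cs ≅ node ds

    data _≅ᶠ_ : List (D × Tree) → List (D × Tree) → Set where
      f-nil   : [] ≅ᶠ []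
      f-cons  : ∀ {d e s t cs ds} → d ≡ e → s ≅ t → cs ≅ᶠ ds →
              ((d , s) ∷ cs) ≅ᶠ ((e , t) ∷ ds)
      f-swap  : ∀ p q cs → (p ∷ q ∷ cs) ≅ᶠ (q ∷ p ∷ cs)
      f-trans : ∀ {cs ds es} → cs ≅ᶠ ds → ds ≅ᶠ es → cs ≅ᶠ es

  HasEdge : Tree → Set
  HasEdge (node [])      = ⊥
  HasEdge (node (_ ∷ _)) = ⊤

  T⁺ : Set
  T⁺ = Σ Tree HasEdge

  -- T₁ ∘_v T₂: identify the root of T₁ with a vertex v of T₂ (root of T₂ kept).
  -- Grafting at the root:
  graftRoot : T⁺ → T⁺ → T⁺
  graftRoot (node (k ∷ ks) , _) (node cs , _) = node (k ∷ ks ++ cs) , tt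

  -- all graftings of t₁ at a vertex of a forest, the roots of the forest
  -- excluded (each result given as first child and remaining children),
  -- and all graftings of t₁ at any vertex of a tree
  mutual
    graftKids : Tree → List (D × Tree) → List ((D × Tree) × List (D × Tree))
    graftKids t₁ [] = []
    graftKids t₁ ((d , s) ∷ cs) =
      map (λ s' → ((d , s') , cs)) (graftAll t₁ s)
      ++ map (λ hr → ((d , s) , (proj₁ hr ∷ proj₂ hr))) (graftKids t₁ cs)

    graftAll : Tree → Tree → List Tree
    graftAll t₁ (node cs) =
      node (kids t₁ ++ cs) ∷ map (λ hr → node (proj₁ hr ∷ proj₂ hr)) (graftKids t₁ cs)

  graftNonRoot : T⁺ → T⁺ → List T⁺
  graftNonRoot (t₁ , _) (node cs , _) =
    map (λ hr → (node (proj₁ hr ∷ proj₂ hr) , tt)) (graftKids t₁ cs)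

  LC : Set c
  LC = List (𝕂 × T⁺)

  -- equality in the free K-vector space on isomorphism classes of T⁺
  data _≋_ : LC → LC → Set (c ⊔ ℓ) where
    ≋-refl  : ∀ {x} → x ≋ x
    ≋-sym   : ∀ {x y} → x ≋ y → y ≋ x
    ≋-trans : ∀ {x y z} → x ≋ y → y ≋ z → x ≋ z
    ≋-cons  : ∀ {a b S T x y} → a ≈ b → proj₁ S ≅ proj₁ T → x ≋ y →
              ((a , S) ∷ x) ≋ ((b , T) ∷ y)
    ≋-swap  : ∀ p q x → (p ∷ q ∷ x) ≋ (q ∷ p ∷ x)
    ≋-merge : ∀ a b T x → ((a , T) ∷ (b , T) ∷ x) ≋ ((a + b , T) ∷ x)
    ≋-zero  : ∀ T x → ((0# , T) ∷ x) ≋ x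

  0v : LC
  0v = []

  _⊕_ : LC → LC → LC
  x ⊕ y = x ++ y

  _·_ : 𝕂 → LC → LC
  a · x = map (λ p → (a * proj₁ p , proj₂ p)) x

  _⋎_ : LC → LC → LC
  x ⋎ y = concatMap (λ p → map (λ q → (proj₁ p * proj₁ q , graftRoot (proj₂ p) (proj₂ q))) y) x

  _▷_ : LC → LC → LC
  x ▷ y = concatMap (λ p → concatMap (λ q →
            map (λ T → (proj₁ p * proj₁ q , T)) (graftNonRoot (proj₂ p) (proj₂ q))) y) x

  edge : D → T⁺
  edge d = node ((d , node []) ∷ []) , tt

  -- the smallest subspace containing the one-edge trees and stable
  -- under ⋎ and ▷ (as a predicate on representatives, closed under ≋)
  data Generated : LC → Set (c ⊔ ℓ) where
    g-gen   : ∀ d → Generated ((1# , edge d) ∷ [])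
    g-zero  : Generated 0v
    g-add   : ∀ {x y} → Generated x → Generated y → Generated (x ⊕ y)
    g-scale : ∀ a {x} → Generated x → Generated (a · x)
    g-vee   : ∀ {x y} → Generated x → Generated y → Generated (x ⋎ y)
    g-rhd   : ∀ {x y} → Generated x → Generated y → Generated (x ▷ y)
    g-resp  : ∀ {x y} → x ≋ y → Generated x → Generated y

-- A tree whose root has children p₁, …, pₙ is the ⋎-product of the planted
-- trees with single root edges p₁, …, pₙ. A planted tree with root edge d
-- over a tree t with at least one edge is t ▷ (edge d), since the one-edge
-- tree has exactly one non-root vertex.
module Submission where

open import Defs
open import Data.List using (List; []; _∷_; _++_)
open import Data.List.Properties using (++-identityʳ)
open import Data.Product using (_×_; _,_; proj₁)
open import Data.Unit using (tt)
open import Relation.Binary.PropositionalEquality using (_≡_; refl; cong)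

module Generation {c ℓ} (K : Field c ℓ) (D : Set) where
  open Field K using (_≈_; 1#; *-identityˡ; *-identityʳ)
  open CK K D

  mutual
    ≅-refl : ∀ t → t ≅ t
    ≅-refl (node cs) = node-cong (≅ᶠ-refl cs)

    ≅ᶠ-refl : ∀ cs → cs ≅ᶠ cs
    ≅ᶠ-refl []             = f-nil
    ≅ᶠ-refl ((d , s) ∷ cs) = f-cons refl (≅-refl s) (≅ᶠ-refl cs)

  ≅-reflexive : ∀ {s t} → s ≡ t → s ≅ t
  ≅-reflexive refl = ≅-refl _

  ≋-singleton : ∀ {a b} {S T : T⁺} → a ≈ b → proj₁ S ≅ proj₁ T →
                ((a , S) ∷ []) ≋ ((b , T) ∷ [])
  ≋-singleton a≈b S≅T = ≋-cons a≈b S≅T ≋-refl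

  monomial : T⁺ → LC
  monomial T = (1# , T) ∷ []

  planted : D × Tree → T⁺
  planted p = node (p ∷ []) , tt

  rooted : D × Tree → List (D × Tree) → T⁺
  rooted p ps = node (p ∷ ps) , tt

  ▷-edge-planted : ∀ d p ps →
                   (monomial (rooted p ps) ▷ monomial (edge d)) ≋ monomial (planted (d , node (p ∷ ps)))
  ▷-edge-planted d p ps =
    ≋-singleton (*-identityˡ 1#)
      (node-cong (f-cons refl (≅-reflexive (cong (λ qs → node (p ∷ qs)) (++-identityʳ ps))) f-nil))

  ⋎-planted-rooted : ∀ p q qs →
                     (monomial (planted p) ⋎ monomial (rooted q qs)) ≋ monomial (rooted p (q ∷ qs))
  ⋎-planted-rooted p q qs = ≋-singleton (*-identityˡ 1#) (≅-refl _)

  ·-monomial : ∀ a T → (a · monomial T) ≋ ((a , T) ∷ [])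
  ·-monomial a T = ≋-singleton (*-identityʳ a) (≅-refl _)

  mutual
    generated-planted : ∀ p → Generated (monomial (planted p))
    generated-planted (d , node [])       = g-gen d
    generated-planted (d , node (q ∷ qs)) =
      g-resp (▷-edge-planted d q qs) (g-rhd (generated-rooted q qs) (g-gen d))

    generated-rooted : ∀ p ps → Generated (monomial (rooted p ps))
    generated-rooted p []       = generated-planted p
    generated-rooted p (q ∷ qs) =
      g-resp (⋎-planted-rooted p q qs) (g-vee (generated-planted p) (generated-rooted q qs))

  generated : ∀ x → Generated x
  generated []                                = g-zero
  generated ((a , (node [] , ())) ∷ x)
  generated ((a , (node (p ∷ ps) , tt)) ∷ x) =
    g-add (g-resp (·-monomial a _) (g-scale a (generated-rooted p ps))) (generated x)

mainTheorem5 : ∀ {c ℓ} (K : Field c ℓ) → CharZero K →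
    (D : Set) → D →
    (x : CK.LC K D) → CK.Generated K D x
mainTheorem5 K _ D _ = Generation.generated K D
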